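{- For all $n\ge1$, $\mathcal{A}(\overline{P_n})=\dfrac{(n+1)F_{n+2}+(2n-1)F_{n+1}}{5F_{n+1}}$.
   Context: All graphs are finite, simple and undirected. A coloring of a graph $G$ assigns colors to its vertices so that adjacent vertices receive different colors; two colorings are equivalent if they induce the same partition of the vertex set into color classes. $S(G,k)$ denotes the number of non-equivalent colorings of $G$ using exactly $k$ colors. Set $\mathcal{B}(G)=\sum_{k\ge1}S(G,k)$, $\mathcal{T}(G)=\sum_{k\ge1}kS(G,k)$ and $\mathcal{A}(G)=\mathcal{T}(G)/\mathcal{B}(G)$. $\overline{P_n}$ is the complement of the path $P_n$ on $n$ vertices. $F_n$ is the $n$th Fibonacci number, $F_1=F_2=1$, $F_{n}=F_{n-1}+F_{n-2}$. -}

module Defs where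

open import Data.Nat using (ℕ; zero; suc; _+_; _*_; _∸_; _⊔_; _≤ᵇ_; _≡ᵇ_)
open import Data.Bool using (Bool; true; false; _∧_; _∨_; not)
open import Data.Fin using (Fin; toℕ)
open import Data.Vec using (Vec; []; _∷_; lookup)
open import Data.List using (List; []; _∷_; [_]; map; concatMap; length; filterᵇ; allFin)
open import Data.Bool.ListAction using (all; any)

-- A finite simple graph on vertex set Fin n, given by a Boolean adjacency
-- relation (intended symmetric and irreflexive).
record Graph (n : ℕ) : Set where
  field
    adj : Fin n → Fin n → Bool
open Graph public

Pbar : (n : ℕ) → Graph n
Pbar n = record { adj = λ i j →
  not (toℕ i ≡ᵇ toℕ j) ∧ not (suc (toℕ i) ≡ᵇ toℕ j) ∧ not (suc (toℕ j) ≡ᵇ toℕ i) }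

allVecs : (n k : ℕ) → List (Vec (Fin k) n)
allVecs zero    k = [ [] ]
allVecs (suc n) k = concatMap (λ a → map (a ∷_) (allVecs n k)) (allFin k)

_==ᶠ_ : {k : ℕ} → Fin k → Fin k → Bool
a ==ᶠ b = toℕ a ≡ᵇ toℕ b

proper : {n k : ℕ} → Graph n → Vec (Fin k) n → Bool
proper {n} G c = all (λ i → all (λ j → not (adj G i j) ∨ not (lookup c i ==ᶠ lookup c j)) (allFin n)) (allFin n)

surjective : {n k : ℕ} → Vec (Fin k) n → Bool
surjective {n} {k} c = all (λ a → any (λ i → lookup c i ==ᶠ a) (allFin n)) (allFin k)

-- canonical representative of an equivalence class of colorings
-- (same partition into color classes): colors appear for the first time
-- in increasing order 0,1,2,… (restricted growth string).
-- m = number of distinct colors used so far.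
canonicalFrom : {n k : ℕ} → ℕ → Vec (Fin k) n → Bool
canonicalFrom m []       = true
canonicalFrom m (x ∷ xs) = (toℕ x ≤ᵇ m) ∧ canonicalFrom (m ⊔ suc (toℕ x)) xs

canonical : {n k : ℕ} → Vec (Fin k) n → Bool
canonical = canonicalFrom 0

-- S(G,k): number of non-equivalent colorings of G using exactly k colors
-- (each equivalence class counted via its unique canonical representative).
S : {n : ℕ} → Graph n → ℕ → ℕ
S {n} G k = length (filterᵇ (λ c → proper G c ∧ surjective c ∧ canonical c) (allVecs n k))

sumTo : ℕ → (ℕ → ℕ) → ℕ
sumTo zero    f = 0
sumTo (suc m) f = sumTo m f + f (suc m)

-- B(G) = Σ_{k≥1} S(G,k); terms with k > n vanish, so summing to n suffices.
𝓑 : {n : ℕ} → Graph n → ℕ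
𝓑 {n} G = sumTo n (λ k → S G k)

𝓣 : {n : ℕ} → Graph n → ℕ
𝓣 {n} G = sumTo n (λ k → k * S G k)

F : ℕ → ℕ
F zero          = 0
F (suc zero)    = 1
F (suc (suc n)) = F (suc n) + F n

-- The colour classes of a proper colouring of the complement of the path
-- P_n are the cliques of P_n: single vertices and pairs of consecutive
-- vertices. Reading a canonical colouring from left to right, each vertex
-- either opens a new colour or, if its predecessor is still alone in its
-- class, joins that class. This two-state transfer yields a mutual
-- recursion for S in the number of vertices. Summed over k, the counts of
-- the two states obey the Fibonacci recurrence, and the k-weighted sums obey
-- a linear recurrence driven by them, which is solved by induction.

module Submission where

open import Defs
open import Data.Bool using (Bool; true; false; _∧_; _∨_; not; if_then_else_; T; T?)
open import Data.Bool.ListAction using (all; any)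
open import Data.Bool.Properties
  using (∨-assoc; ∨-identityʳ; ∧-zeroʳ; not-involutive; ∧-idempotentCommutativeMonoid)
open import Data.Fin using (Fin; toℕ; zero; suc)
open import Data.List using (List; []; _∷_; [_]; _++_; map; length; filterᵇ; tabulate; concatMap)
open import Data.List.Properties using (length-++; filter-++; filter-≐)
open import Data.Nat
  using (ℕ; zero; suc; _+_; _*_; _∸_; _≤_; _<_; _⊔_; _≤ᵇ_; _<ᵇ_; _≡ᵇ_; _≟_; _<?_; _≤?_; z≤n; s≤s)
open import Data.Nat.Properties
  using ( +-0-commutativeMonoid; +-commutativeSemigroup; +-identityʳ; +-assoc; +-suc; *-zeroʳ
        ; *-distribˡ-+; ⊔-idem; m≤n⇒m⊔n≡n; ≤-refl; n≤1+n; m≤m+n; n<1+n; n≮n; <⇒≤; <⇒≢; >⇒≢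
        ; <⇒≱; <⇒≯; m<n⇒m<1+n; 1+n≢n)
open import Data.Nat.Tactic.RingSolver using (solve-∀)
open import Data.Product using (_×_; _,_; proj₁; proj₂)
open import Data.Vec using (Vec; []; _∷_; lookup)
open import Function using (_∘_)
open import Relation.Nullary using (¬_)
open import Relation.Nullary.Decidable using (dec-true; dec-false)
open import Relation.Binary.PropositionalEquality
  using (_≡_; _≢_; refl; sym; trans; cong; cong₂; subst; module ≡-Reasoning)

open import Algebra.Properties.CommutativeMonoid.Sum +-0-commutativeMonoid
  using (sum; sum-cong-≗; ∑-distrib-+; sum-replicate-zero)
open import Algebra.Properties.CommutativeSemigroup +-commutativeSemigroup using (interchange)
open import Algebra.Solver.IdempotentCommutativeMonoid ∧-idempotentCommutativeMonoid
  using (solve; _⊜_; _⊕_; id)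

allᵇ : (n : ℕ) → (Fin n → Bool) → Bool
allᵇ zero    p = true
allᵇ (suc n) p = p zero ∧ allᵇ n (p ∘ suc)

anyᵇ : (n : ℕ) → (Fin n → Bool) → Bool
anyᵇ zero    p = false
anyᵇ (suc n) p = p zero ∨ anyᵇ n (p ∘ suc)

all-tabulate : ∀ {A : Set} n (f : Fin n → A) (p : A → Bool) → all p (tabulate f) ≡ allᵇ n (p ∘ f)
all-tabulate zero    f p = refl
all-tabulate (suc n) f p = cong (p (f zero) ∧_) (all-tabulate n (f ∘ suc) p)

any-tabulate : ∀ {A : Set} n (f : Fin n → A) (p : A → Bool) → any p (tabulate f) ≡ anyᵇ n (p ∘ f)
any-tabulate zero    f p = refl
any-tabulate (suc n) f p = cong (p (f zero) ∨_) (any-tabulate n (f ∘ suc) p)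

allᵇ-cong : ∀ n {p q : Fin n → Bool} → (∀ i → p i ≡ q i) → allᵇ n p ≡ allᵇ n q
allᵇ-cong zero    p≗q = refl
allᵇ-cong (suc n) p≗q = cong₂ _∧_ (p≗q zero) (allᵇ-cong n (p≗q ∘ suc))

allᵇ-∧ : ∀ n (p q : Fin n → Bool) → allᵇ n (λ i → p i ∧ q i) ≡ allᵇ n p ∧ allᵇ n q
allᵇ-∧ zero    p q = refl
allᵇ-∧ (suc n) p q = trans (cong ((p zero ∧ q zero) ∧_) (allᵇ-∧ n (p ∘ suc) (q ∘ suc)))
  (solve 4 (λ a b c d → (a ⊕ b) ⊕ (c ⊕ d) ⊜ (a ⊕ c) ⊕ (b ⊕ d)) refl (p zero) (q zero) _ _)

≡ᵇ-sym : ∀ m n → (m ≡ᵇ n) ≡ (n ≡ᵇ m)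
≡ᵇ-sym zero    zero    = refl
≡ᵇ-sym zero    (suc n) = refl
≡ᵇ-sym (suc m) zero    = refl
≡ᵇ-sym (suc m) (suc n) = ≡ᵇ-sym m n

_∪_ : ∀ {k} → (Fin k → Bool) → (Fin k → Bool) → Fin k → Bool
(P ∪ Q) y = P y ∨ Q y

∅ : ∀ {k} → Fin k → Bool
∅ _ = false

below at : ∀ {k} → ℕ → Fin k → Bool
below p y = toℕ y <ᵇ p
at    t y = toℕ y ≡ᵇ t

avoids : ∀ {k n} → (Fin k → Bool) → Vec (Fin k) n → Bool
avoids P []      = true
avoids P (y ∷ c) = not (P y) ∧ avoids P c

avoidsTail : ∀ {k n} → (Fin k → Bool) → Vec (Fin k) n → Bool
avoidsTail P []      = true
avoidsTail P (_ ∷ c) = avoids P c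

-- In P̄ a vertex is adjacent to everything but its path neighbours, so a
-- colouring is proper iff each entry differs from all entries after the next.
properᴾ : ∀ {k n} → Vec (Fin k) n → Bool
properᴾ []      = true
properᴾ (x ∷ c) = avoidsTail (at (toℕ x)) c ∧ properᴾ c

avoids-allᵇ : ∀ {k n} (P : Fin k → Bool) (c : Vec (Fin k) n) →
  avoids P c ≡ allᵇ n (λ j → not (P (lookup c j)))
avoids-allᵇ P []      = refl
avoids-allᵇ P (y ∷ c) = cong (not (P y) ∧_) (avoids-allᵇ P c)

avoidsTail-allᵇ : ∀ {k n} (P : Fin k → Bool) (c : Vec (Fin k) n) →
  avoidsTail P c ≡ allᵇ n (λ j → (toℕ j ≡ᵇ 0) ∨ not (P (lookup c j)))
avoidsTail-allᵇ P []      = refl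
avoidsTail-allᵇ P (y ∷ c) = avoids-allᵇ P c

proper′ : ∀ {n k} → Graph n → Vec (Fin k) n → Bool
proper′ {n} G c = allᵇ n (λ i → allᵇ n (λ j → not (adj G i j) ∨ not (lookup c i ==ᶠ lookup c j)))

proper-proper′ : ∀ {n k} (G : Graph n) (c : Vec (Fin k) n) → proper G c ≡ proper′ G c
proper-proper′ {n} G c =
  trans (all-tabulate n (λ i → i) _) (allᵇ-cong n (λ i → all-tabulate n (λ j → j) _))

Pbar-adj-zero-suc : ∀ {n} (j : Fin n) → adj (Pbar (suc n)) zero (suc j) ≡ not (toℕ j ≡ᵇ 0)
Pbar-adj-zero-suc j with toℕ j
... | zero  = refl
... | suc _ = refl

Pbar-adj-suc-zero : ∀ {n} (i : Fin n) → adj (Pbar (suc n)) (suc i) zero ≡ not (toℕ i ≡ᵇ 0)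
Pbar-adj-suc-zero i with toℕ i
... | zero  = refl
... | suc _ = refl

proper′-Pbar-∷ : ∀ {n k} (x : Fin k) (c : Vec (Fin k) n) →
  proper′ (Pbar (suc n)) (x ∷ c) ≡ avoidsTail (at (toℕ x)) c ∧ proper′ (Pbar n) c
proper′-Pbar-∷ {n} x c = begin
  proper′ (Pbar (suc n)) (x ∷ c)
    ≡⟨ cong₂ _∧_ (allᵇ-cong n row) (allᵇ-cong n (λ i → cong (_∧ _) (column i))) ⟩
  apart ∧ allᵇ n (λ i → apartAt i ∧ _)
    ≡⟨ cong (apart ∧_) (allᵇ-∧ n apartAt _) ⟩
  apart ∧ (apart ∧ proper′ (Pbar n) c)
    ≡⟨ solve 2 (λ a b → a ⊕ (a ⊕ b) ⊜ a ⊕ b) refl apart _ ⟩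
  apart ∧ proper′ (Pbar n) c
    ≡⟨ cong (_∧ _) (sym (avoidsTail-allᵇ (at (toℕ x)) c)) ⟩
  avoidsTail (at (toℕ x)) c ∧ proper′ (Pbar n) c ∎
  where
  open ≡-Reasoning
  apartAt : Fin n → Bool
  apartAt j = (toℕ j ≡ᵇ 0) ∨ not (lookup c j ==ᶠ x)
  apart : Bool
  apart = allᵇ n apartAt
  row : ∀ j → not (adj (Pbar (suc n)) zero (suc j)) ∨ not (x ==ᶠ lookup c j) ≡ apartAt j
  row j = cong₂ _∨_ (trans (cong not (Pbar-adj-zero-suc j)) (not-involutive _))
                   (cong not (≡ᵇ-sym (toℕ x) (toℕ (lookup c j))))
  column : ∀ i → not (adj (Pbar (suc n)) (suc i) zero) ∨ not (lookup c i ==ᶠ x) ≡ apartAt i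
  column i = cong (_∨ not (lookup c i ==ᶠ x)) (trans (cong not (Pbar-adj-suc-zero i)) (not-involutive _))

proper-Pbar : ∀ {n k} (c : Vec (Fin k) n) → proper (Pbar n) c ≡ properᴾ c
proper-Pbar c = trans (proper-proper′ (Pbar _) c) (proper′-properᴾ c)
  where
  proper′-properᴾ : ∀ {n k} (c : Vec (Fin k) n) → proper′ (Pbar n) c ≡ properᴾ c
  proper′-properᴾ []      = refl
  proper′-properᴾ (x ∷ c) =
    trans (proper′-Pbar-∷ x c) (cong (avoidsTail (at (toℕ x)) c ∧_) (proper′-properᴾ c))

covers : ∀ {k n} → (Fin k → Bool) → Vec (Fin k) n → Bool
covers {k} C []      = allᵇ k C
covers     C (x ∷ c) = covers (C ∪ at (toℕ x)) c

covers-allᵇ : ∀ {k n} (C : Fin k → Bool) (c : Vec (Fin k) n) →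
  covers C c ≡ allᵇ k (λ b → C b ∨ anyᵇ n (λ i → lookup c i ==ᶠ b))
covers-allᵇ {k} C []      = allᵇ-cong k (λ b → sym (∨-identityʳ (C b)))
covers-allᵇ {k} {suc n} C (x ∷ c) = trans (covers-allᵇ _ c) (allᵇ-cong k λ b →
  trans (cong (λ e → (C b ∨ e) ∨ anyᵇ n (λ i → lookup c i ==ᶠ b)) (≡ᵇ-sym (toℕ b) (toℕ x)))
        (∨-assoc (C b) _ _))

surjective-covers : ∀ {k n} (c : Vec (Fin k) n) → surjective c ≡ covers ∅ c
surjective-covers {k} {n} c = trans
  (trans (all-tabulate k (λ b → b) _) (allᵇ-cong k (λ b → any-tabulate n (λ i → i) _)))
  (sym (covers-allᵇ ∅ c))

avoids-∅ : ∀ {k n} (c : Vec (Fin k) n) → avoids ∅ c ≡ true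
avoids-∅ []      = refl
avoids-∅ (_ ∷ c) = avoids-∅ c

avoidsTail-∅ : ∀ {k n} (c : Vec (Fin k) n) → avoidsTail ∅ c ≡ true
avoidsTail-∅ []      = refl
avoidsTail-∅ (_ ∷ c) = avoids-∅ c

avoids-∪ : ∀ {k n} (P Q : Fin k → Bool) (c : Vec (Fin k) n) →
  avoids (P ∪ Q) c ≡ avoids P c ∧ avoids Q c
avoids-∪ P Q []      = refl
avoids-∪ P Q (y ∷ c) with P y | Q y
... | true  | _     = refl
... | false | true  = sym (∧-zeroʳ (avoids P c))
... | false | false = avoids-∪ P Q c

-- c continues a canonical proper colouring of a prefix that used m colours:
-- colours in F are barred from all of c, colours in L (the colour of the last
-- prefix vertex) from all of c but its first entry, and C are the colours used.
admissible : ∀ {k n} → ℕ → (F L C : Fin k → Bool) → Vec (Fin k) n → Bool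
admissible m F L C c = canonicalFrom m c ∧ properᴾ c ∧ avoids F c ∧ avoidsTail L c ∧ covers C c

admissible-∷ : ∀ {k n} m (F L C : Fin k → Bool) (x : Fin k) (c : Vec (Fin k) n) →
  admissible m F L C (x ∷ c)
    ≡ (not (F x) ∧ (toℕ x ≤ᵇ m))
      ∧ admissible (m ⊔ suc (toℕ x)) (F ∪ L) (at (toℕ x)) (C ∪ at (toℕ x)) c
admissible-∷ m F L C x c rewrite avoids-∪ F L c =
  solve 8 (λ le can tl pr nF aF aL cv → (le ⊕ can) ⊕ (tl ⊕ pr) ⊕ (nF ⊕ aF) ⊕ aL ⊕ cv
                                       ⊜ (nF ⊕ le) ⊕ can ⊕ pr ⊕ (aF ⊕ aL) ⊕ tl ⊕ cv) refl
    (toℕ x ≤ᵇ m) (canonicalFrom (m ⊔ suc (toℕ x)) c) (avoidsTail (at (toℕ x)) c) (properᴾ c)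
    (not (F x)) (avoids F c) (avoids L c) (covers (C ∪ at (toℕ x)) c)

avoids-cong : ∀ {k n} {P Q : Fin k → Bool} → (∀ y → P y ≡ Q y) → (c : Vec (Fin k) n) →
  avoids P c ≡ avoids Q c
avoids-cong P≗Q []      = refl
avoids-cong P≗Q (y ∷ c) = cong₂ _∧_ (cong not (P≗Q y)) (avoids-cong P≗Q c)

avoidsTail-cong : ∀ {k n} {P Q : Fin k → Bool} → (∀ y → P y ≡ Q y) → (c : Vec (Fin k) n) →
  avoidsTail P c ≡ avoidsTail Q c
avoidsTail-cong P≗Q []      = refl
avoidsTail-cong P≗Q (_ ∷ c) = avoids-cong P≗Q c

covers-cong : ∀ {k n} {C D : Fin k → Bool} → (∀ y → C y ≡ D y) → (c : Vec (Fin k) n) →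
  covers C c ≡ covers D c
covers-cong {k} C≗D []      = allᵇ-cong k C≗D
covers-cong     C≗D (x ∷ c) = covers-cong (λ y → cong (_∨ at (toℕ x) y) (C≗D y)) c

admissible-cong : ∀ {k n} m {F F′ L L′ C C′ : Fin k → Bool} →
  (∀ y → F y ≡ F′ y) → (∀ y → L y ≡ L′ y) → (∀ y → C y ≡ C′ y) →
  (c : Vec (Fin k) n) → admissible m F L C c ≡ admissible m F′ L′ C′ c
admissible-cong m F≗F′ L≗L′ C≗C′ c =
  cong₂ (λ a b → canonicalFrom m c ∧ properᴾ c ∧ a ∧ b) (avoids-cong F≗F′ c)
    (cong₂ _∧_ (avoidsTail-cong L≗L′ c) (covers-cong C≗C′ c))

coloring-admissible : ∀ {k n} (c : Vec (Fin k) n) →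
  (proper (Pbar n) c ∧ surjective c ∧ canonical c) ≡ admissible 0 ∅ ∅ ∅ c
coloring-admissible c rewrite proper-Pbar c | surjective-covers c | avoids-∅ c | avoidsTail-∅ c =
  solve 3 (λ pr cv can → pr ⊕ cv ⊕ can ⊜ can ⊕ pr ⊕ id ⊕ id ⊕ cv) refl
    (properᴾ c) (covers ∅ c) (canonical c)

count : ∀ {A : Set} → (A → Bool) → List A → ℕ
count p xs = length (filterᵇ p xs)

count-++ : ∀ {A : Set} (p : A → Bool) xs ys → count p (xs ++ ys) ≡ count p xs + count p ys
count-++ p xs ys = trans (cong length (filter-++ (T? ∘ p) xs ys)) (length-++ (filterᵇ p xs))

count-cong : ∀ {A : Set} {p q : A → Bool} → (∀ x → p x ≡ q x) → ∀ xs → count p xs ≡ count q xs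
count-cong {p = p} {q} p≗q xs =
  cong length (filter-≐ (T? ∘ p) (T? ∘ q)
                        ((λ {x} → subst T (p≗q x)) , (λ {x} → subst T (sym (p≗q x)))) xs)

count-map : ∀ {A B : Set} (p : B → Bool) (f : A → B) xs → count p (map f xs) ≡ count (p ∘ f) xs
count-map p f []       = refl
count-map p f (x ∷ xs) with p (f x)
... | true  = cong suc (count-map p f xs)
... | false = count-map p f xs

count-none : ∀ {A : Set} (xs : List A) → count (λ _ → false) xs ≡ 0
count-none []       = refl
count-none (_ ∷ xs) = count-none xs

count-guard : ∀ {A : Set} b (q : A → Bool) xs →
  count (λ x → b ∧ q x) xs ≡ (if b then count q xs else 0)
count-guard true  q xs = refl
count-guard false q xs = count-none xs

count-[] : ∀ {A : Set} (p : A → Bool) x → count p [ x ] ≡ (if p x then 1 else 0)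
count-[] p x with p x
... | true  = refl
... | false = refl

count-concatMap : ∀ {A B : Set} (p : B → Bool) (g : A → List B) {k} (f : Fin k → A) →
  count p (concatMap g (tabulate f)) ≡ sum (λ i → count p (g (f i)))
count-concatMap p g {zero}  f = refl
count-concatMap p g {suc k} f =
  trans (count-++ p (g (f zero)) _) (cong (count p (g (f zero)) +_) (count-concatMap p g (f ∘ suc)))

count-admissible-∷ : ∀ n k m (F L C : Fin k → Bool) →
  count (admissible m F L C) (allVecs (suc n) k)
    ≡ sum (λ x → if not (F x) ∧ (toℕ x ≤ᵇ m)
                 then count (admissible (m ⊔ suc (toℕ x)) (F ∪ L) (at (toℕ x)) (C ∪ at (toℕ x)))
                            (allVecs n k)
                 else 0)
count-admissible-∷ n k m F L C =
  trans (count-concatMap _ (λ x → map (x ∷_) (allVecs n k)) (λ x → x)) (sum-cong-≗ λ x →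
    trans (count-map _ (x ∷_) (allVecs n k))
      (trans (count-cong (admissible-∷ m F L C x) (allVecs n k)) (count-guard _ _ (allVecs n k))))

<ᵇ-true : ∀ {m n} → m < n → (m <ᵇ n) ≡ true
<ᵇ-true {m} {n} = dec-true (m <? n)

<ᵇ-false : ∀ {m n} → ¬ m < n → (m <ᵇ n) ≡ false
<ᵇ-false {m} {n} = dec-false (m <? n)

≤ᵇ-true : ∀ {m n} → m ≤ n → (m ≤ᵇ n) ≡ true
≤ᵇ-true {m} {n} = dec-true (m ≤? n)

≤ᵇ-false : ∀ {m n} → ¬ m ≤ n → (m ≤ᵇ n) ≡ false
≤ᵇ-false {m} {n} = dec-false (m ≤? n)

≡ᵇ-refl : ∀ n → (n ≡ᵇ n) ≡ true
≡ᵇ-refl n = dec-true (n ≟ n) refl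

≡ᵇ-false : ∀ {m n} → m ≢ n → (m ≡ᵇ n) ≡ false
≡ᵇ-false {m} {n} = dec-false (m ≟ n)

<ᵇ-suc : ∀ y p → (y <ᵇ p) ∨ (y ≡ᵇ p) ≡ (y <ᵇ suc p)
<ᵇ-suc zero    zero    = refl
<ᵇ-suc zero    (suc p) = refl
<ᵇ-suc (suc y) zero    = refl
<ᵇ-suc (suc y) (suc p) = <ᵇ-suc y p

<ᵇ-suc-absorb : ∀ y p → (y <ᵇ suc p) ∨ (y ≡ᵇ p) ≡ (y <ᵇ suc p)
<ᵇ-suc-absorb zero    p       = refl
<ᵇ-suc-absorb (suc y) zero    = refl
<ᵇ-suc-absorb (suc y) (suc p) = <ᵇ-suc-absorb y p

data Position (p : ℕ) : ℕ → Set where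
  before : ∀ {t} → t < p → Position p t
  equal  : Position p p
  next   : Position p (suc p)
  after  : ∀ {t} → suc p < t → Position p t

position : ∀ p t → Position p t
position zero    zero          = equal
position zero    (suc zero)    = next
position zero    (suc (suc t)) = after (s≤s (s≤s z≤n))
position (suc p) zero          = before (s≤s z≤n)
position (suc p) (suc t) with position p t
... | before t<p  = before (s≤s t<p)
... | equal       = equal
... | next        = next
... | after sp<t  = after (s≤s sp<t)

-- The prefix used the colours 0,…,p and its last vertex has colour p; the state
-- is open if that vertex is still alone in its class, so the next one may join it.
openAt closedAt : ∀ {k n} → ℕ → Vec (Fin k) n → Bool
openAt   p = admissible (suc p) (below p)       (at p) (below (suc p))
closedAt p = admissible (suc p) (below (suc p)) (at p) (below (suc p))

openCount closedCount : ℕ → ℕ → ℕ → ℕ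
openCount   n k p = count (openAt p)   (allVecs n k)
closedCount n k p = count (closedAt p) (allVecs n k)

open-transition : ∀ n k p t →
  (if not (t <ᵇ p) ∧ (t ≤ᵇ suc p)
   then count (admissible (suc p ⊔ suc t) (below p ∪ at p) (at t) (below (suc p) ∪ at t)) (allVecs n k)
   else 0)
  ≡ (if t ≡ᵇ suc p then openCount n k (suc p) else 0) + (if t ≡ᵇ p then closedCount n k p else 0)
open-transition n k p t with position p t
... | before t<p
  rewrite <ᵇ-true t<p | ≡ᵇ-false (<⇒≢ t<p) | ≡ᵇ-false (<⇒≢ (m<n⇒m<1+n t<p)) = refl
... | equal
  rewrite <ᵇ-false (n≮n p) | ≤ᵇ-true (n≤1+n p) | ≡ᵇ-refl p | ≡ᵇ-false (<⇒≢ (n<1+n p))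
        | ⊔-idem (suc p)
  = count-cong (admissible-cong (suc p) (λ y → <ᵇ-suc (toℕ y) p) (λ _ → refl)
                                        (λ y → <ᵇ-suc-absorb (toℕ y) p)) (allVecs n k)
... | next
  rewrite <ᵇ-false (<⇒≯ (n<1+n p)) | ≤ᵇ-true (≤-refl {suc p})
        | ≡ᵇ-false (1+n≢n {p}) | ≡ᵇ-refl (suc p) | m≤n⇒m⊔n≡n (n≤1+n (suc p)) | +-identityʳ (openCount n k (suc p))
  = count-cong (admissible-cong (suc (suc p)) (λ y → <ᵇ-suc (toℕ y) p) (λ _ → refl)
                                              (λ y → <ᵇ-suc (toℕ y) (suc p))) (allVecs n k)
... | after sp<t
  rewrite <ᵇ-false (<⇒≯ (<⇒≤ sp<t)) | ≤ᵇ-false (<⇒≱ sp<t)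
        | ≡ᵇ-false (>⇒≢ (<⇒≤ sp<t)) | ≡ᵇ-false (>⇒≢ sp<t) = refl

closed-transition : ∀ n k p t →
  (if not (t <ᵇ suc p) ∧ (t ≤ᵇ suc p)
   then count (admissible (suc p ⊔ suc t) (below (suc p) ∪ at p) (at t) (below (suc p) ∪ at t)) (allVecs n k)
   else 0)
  ≡ (if t ≡ᵇ suc p then openCount n k (suc p) else 0)
closed-transition n k p t with position p t
... | before t<p rewrite <ᵇ-true (m<n⇒m<1+n t<p) | ≡ᵇ-false (<⇒≢ (m<n⇒m<1+n t<p)) = refl
... | equal      rewrite <ᵇ-true (n<1+n p) | ≡ᵇ-false (<⇒≢ (n<1+n p)) = refl
... | next
  rewrite <ᵇ-false (n≮n (suc p)) | ≤ᵇ-true (≤-refl {suc p}) | ≡ᵇ-refl (suc p)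
        | m≤n⇒m⊔n≡n (n≤1+n (suc p))
  = count-cong (admissible-cong (suc (suc p)) (λ y → <ᵇ-suc-absorb (toℕ y) p) (λ _ → refl)
                                              (λ y → <ᵇ-suc (toℕ y) (suc p))) (allVecs n k)
... | after sp<t rewrite <ᵇ-false (<⇒≯ sp<t) | ≤ᵇ-false (<⇒≱ sp<t) | ≡ᵇ-false (>⇒≢ sp<t) = refl

initial-transition : ∀ n k t →
  (if t ≤ᵇ 0 then count (admissible (suc t) (∅ ∪ ∅) (at t) (∅ ∪ at t)) (allVecs n k) else 0)
  ≡ (if t ≡ᵇ 0 then openCount n k 0 else 0)
initial-transition n k zero    =
  count-cong (admissible-cong 1 (λ _ → refl) (λ _ → refl) (λ y → <ᵇ-suc (toℕ y) 0)) (allVecs n k)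
initial-transition n k (suc t) = refl

sum-indicator : ∀ k t v → sum {k} (λ x → if toℕ x ≡ᵇ t then v else 0) ≡ (if t <ᵇ k then v else 0)
sum-indicator zero    t       v = refl
sum-indicator (suc k) zero    v = trans (cong (v +_) (sum-replicate-zero k)) (+-identityʳ v)
sum-indicator (suc k) (suc t) v = sum-indicator k t v

openCount-suc : ∀ n k p → p < k →
  openCount (suc n) k p ≡ (if suc p <ᵇ k then openCount n k (suc p) else 0) + closedCount n k p
openCount-suc n k p p<k =
  trans (count-admissible-∷ n k (suc p) (below p) (at p) (below (suc p)))
  (trans (sum-cong-≗ {k} (λ x → open-transition n k p (toℕ x)))
  (trans (∑-distrib-+ {k} _ _)
         (cong₂ _+_ (sum-indicator k (suc p) _)
                    (trans (sum-indicator k p _)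
                           (cong (λ b → if b then closedCount n k p else 0) (<ᵇ-true p<k))))))

closedCount-suc : ∀ n k p → closedCount (suc n) k p ≡ (if suc p <ᵇ k then openCount n k (suc p) else 0)
closedCount-suc n k p =
  trans (count-admissible-∷ n k (suc p) (below (suc p)) (at p) (below (suc p)))
  (trans (sum-cong-≗ {k} (λ x → closed-transition n k p (toℕ x))) (sum-indicator k (suc p) _))

-- Continuations of length n when j - 1 colours are still to be introduced; the
-- shift by one makes S (Pbar (suc n)) j ≡ waysOpen n j hold for all j.
mutual
  waysOpen : ℕ → ℕ → ℕ
  waysOpen _       zero    = 0
  waysOpen zero    (suc j) = if j ≡ᵇ 0 then 1 else 0
  waysOpen (suc n) (suc j) = waysOpen n j + waysClosed n (suc j)

  waysClosed : ℕ → ℕ → ℕ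
  waysClosed _       zero    = 0
  waysClosed zero    (suc j) = if j ≡ᵇ 0 then 1 else 0
  waysClosed (suc n) (suc j) = waysOpen n j

allᵇ-below : ∀ m d → allᵇ (m + d) (below m) ≡ (d ≡ᵇ 0)
allᵇ-below zero    zero    = refl
allᵇ-below zero    (suc d) = refl
allᵇ-below (suc m) d       = allᵇ-below m d

stateCount-ways : ∀ n d p → openCount   n (suc p + d) p ≡ waysOpen   n (suc d)
                           × closedCount n (suc p + d) p ≡ waysClosed n (suc d)
stateCount-ways zero d p =
  base (count-[] (openAt {suc p + d} p) []) , base (count-[] (closedAt {suc p + d} p) [])
  where
  base : ∀ {c} → c ≡ (if allᵇ (suc p + d) (below (suc p)) then 1 else 0) →
                 c ≡ (if d ≡ᵇ 0 then 1 else 0)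
  base c≡ = trans c≡ (cong (λ b → if b then 1 else 0) (allᵇ-below (suc p) d))
stateCount-ways (suc n) d p =
  trans (openCount-suc n k p (s≤s (m≤m+n p d)))
        (cong₂ _+_ (nextOpen d) (proj₂ (stateCount-ways n d p))) ,
  trans (closedCount-suc n k p) (nextOpen d)
  where
  k = suc p + d
  nextOpen : ∀ d → (if suc p <ᵇ suc p + d then openCount n (suc p + d) (suc p) else 0) ≡ waysOpen n d
  nextOpen zero    rewrite +-identityʳ p | <ᵇ-false (n≮n (suc p)) = refl
  nextOpen (suc d) rewrite +-suc p d | <ᵇ-true (s≤s (s≤s (m≤m+n p d))) =
    proj₁ (stateCount-ways n d (suc p))

S-Pbar : ∀ n k → S (Pbar (suc n)) k ≡ waysOpen n k
S-Pbar n zero    = refl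
S-Pbar n (suc d) =
  trans (count-cong coloring-admissible (allVecs (suc n) (suc d)))
  (trans (count-admissible-∷ n (suc d) 0 ∅ ∅ ∅)
  (trans (sum-cong-≗ {suc d} (λ x → initial-transition n (suc d) (toℕ x)))
  (trans (sum-indicator (suc d) 0 _) (proj₁ (stateCount-ways n d 0)))))

sumTo-cong : ∀ N {f g : ℕ → ℕ} → (∀ k → f (suc k) ≡ g (suc k)) → sumTo N f ≡ sumTo N g
sumTo-cong zero    f≗g = refl
sumTo-cong (suc N) f≗g = cong₂ _+_ (sumTo-cong N f≗g) (f≗g N)

sumTo-+ : ∀ N (f g : ℕ → ℕ) → sumTo N (λ k → f k + g k) ≡ sumTo N f + sumTo N g
sumTo-+ zero    f g = refl
sumTo-+ (suc N) f g =
  trans (cong (_+ (f (suc N) + g (suc N))) (sumTo-+ N f g)) (interchange (sumTo N f) _ _ _)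

sumTo-suc : ∀ N (f : ℕ → ℕ) → sumTo (suc N) f ≡ f 1 + sumTo N (f ∘ suc)
sumTo-suc zero    f = sym (+-identityʳ (f 1))
sumTo-suc (suc N) f = trans (cong (_+ f (suc (suc N))) (sumTo-suc N f)) (+-assoc (f 1) _ _)

sumTo-last-zero : ∀ N (f : ℕ → ℕ) → f (suc N) ≡ 0 → sumTo (suc N) f ≡ sumTo N f
sumTo-last-zero N f fN≡0 = trans (cong (sumTo N f +_) fN≡0) (+-identityʳ _)

mutual
  waysOpen-vanish : ∀ n j → suc n < j → waysOpen n j ≡ 0
  waysOpen-vanish zero    (suc zero)    (s≤s ())
  waysOpen-vanish zero    (suc (suc j)) _       = refl
  waysOpen-vanish (suc n) (suc j)       (s≤s h) =
    cong₂ _+_ (waysOpen-vanish n j h) (waysClosed-vanish n (suc j) (m<n⇒m<1+n h))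

  waysClosed-vanish : ∀ n j → suc n < j → waysClosed n j ≡ 0
  waysClosed-vanish zero    (suc zero)    (s≤s ())
  waysClosed-vanish zero    (suc (suc j)) _       = refl
  waysClosed-vanish (suc n) (suc j)       (s≤s h) = waysOpen-vanish n j h

totalOpen totalClosed weightOpen weightClosed : ℕ → ℕ
totalOpen    n = sumTo (suc n) (waysOpen n)
totalClosed  n = sumTo (suc n) (waysClosed n)
weightOpen   n = sumTo (suc n) (λ k → k * waysOpen n k)
weightClosed n = sumTo (suc n) (λ k → k * waysClosed n k)

totalOpen-suc : ∀ n → totalOpen (suc n) ≡ totalOpen n + totalClosed n
totalOpen-suc n = begin
  sumTo (2 + n) (waysOpen (suc n))
    ≡⟨ sumTo-cong (2 + n) (λ _ → refl) ⟩
  sumTo (2 + n) (λ j → waysOpen n (j ∸ 1) + waysClosed n j)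
    ≡⟨ sumTo-+ (2 + n) _ (waysClosed n) ⟩
  sumTo (2 + n) (λ j → waysOpen n (j ∸ 1)) + sumTo (2 + n) (waysClosed n)
    ≡⟨ cong₂ _+_ (sumTo-suc (suc n) _)
                 (sumTo-last-zero (suc n) _ (waysClosed-vanish n (2 + n) ≤-refl)) ⟩
  totalOpen n + totalClosed n ∎
  where open ≡-Reasoning

totalClosed-suc : ∀ n → totalClosed (suc n) ≡ totalOpen n
totalClosed-suc n = sumTo-suc (suc n) (waysClosed (suc n))

weightOpen-suc : ∀ n → weightOpen (suc n) ≡ (totalOpen n + weightOpen n) + weightClosed n
weightOpen-suc n = begin
  sumTo (2 + n) (λ j → j * waysOpen (suc n) j)
    ≡⟨ sumTo-cong (2 + n) (λ j → *-distribˡ-+ (suc j) (waysOpen n j) _) ⟩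
  sumTo (2 + n) (λ j → j * waysOpen n (j ∸ 1) + j * waysClosed n j)
    ≡⟨ sumTo-+ (2 + n) _ _ ⟩
  sumTo (2 + n) (λ j → j * waysOpen n (j ∸ 1)) + sumTo (2 + n) (λ j → j * waysClosed n j)
    ≡⟨ cong₂ _+_ (sumTo-suc (suc n) _) (sumTo-last-zero (suc n) _ closed-vanish) ⟩
  sumTo (suc n) (λ j → waysOpen n j + j * waysOpen n j) + weightClosed n
    ≡⟨ cong (_+ weightClosed n) (sumTo-+ (suc n) (waysOpen n) _) ⟩
  (totalOpen n + weightOpen n) + weightClosed n ∎
  where
  open ≡-Reasoning
  closed-vanish : (2 + n) * waysClosed n (2 + n) ≡ 0
  closed-vanish = trans (cong ((2 + n) *_) (waysClosed-vanish n (2 + n) ≤-refl)) (*-zeroʳ (2 + n))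

weightClosed-suc : ∀ n → weightClosed (suc n) ≡ totalOpen n + weightOpen n
weightClosed-suc n = trans (sumTo-suc (suc n) _) (sumTo-+ (suc n) (waysOpen n) _)

totals-fib : ∀ n → totalOpen n ≡ F (2 + n) × totalClosed n ≡ F (1 + n)
totals-fib zero    = refl , refl
totals-fib (suc n) =
  trans (totalOpen-suc n) (cong₂ _+_ (proj₁ (totals-fib n)) (proj₂ (totals-fib n))) ,
  trans (totalClosed-suc n) (proj₁ (totals-fib n))

weights-fib : ∀ n → 5 * weightOpen n   ≡ (n + 2) * F (3 + n) + (2 * n + 1) * F (2 + n)
                  × 5 * weightClosed n ≡ (n + 1) * F (2 + n) + (2 * n + 4) * F (1 + n)
weights-fib zero    = refl , refl
weights-fib (suc n) = open-step , closed-step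
  where
  open ≡-Reasoning
  u = F (1 + n)
  v = F (2 + n)
  A = totalOpen n
  W = weightOpen n
  W′ = weightClosed n
  A≡v : A ≡ v
  A≡v = proj₁ (totals-fib n)
  IH₁ : 5 * W ≡ (n + 2) * (v + u) + (2 * n + 1) * v
  IH₁ = proj₁ (weights-fib n)
  IH₂ : 5 * W′ ≡ (n + 1) * v + (2 * n + 4) * u
  IH₂ = proj₂ (weights-fib n)

  open-step : 5 * weightOpen (suc n) ≡ (suc n + 2) * F (3 + suc n) + (2 * suc n + 1) * F (2 + suc n)
  open-step = begin
    5 * weightOpen (suc n)       ≡⟨ cong (5 *_) (weightOpen-suc n) ⟩
    5 * ((A + W) + W′)           ≡⟨ distrib A W W′ ⟩
    5 * A + 5 * W + 5 * W′       ≡⟨ cong₂ _+_ (cong₂ _+_ (cong (5 *_) A≡v) IH₁) IH₂ ⟩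
    5 * v + ((n + 2) * (v + u) + (2 * n + 1) * v) + ((n + 1) * v + (2 * n + 4) * u)
                                 ≡⟨ identity n u v ⟩
    (suc n + 2) * ((v + u) + v) + (2 * suc n + 1) * (v + u) ∎
    where
    distrib : ∀ a b c → 5 * ((a + b) + c) ≡ 5 * a + 5 * b + 5 * c
    distrib = solve-∀
    identity : ∀ n u v → 5 * v + ((n + 2) * (v + u) + (2 * n + 1) * v) + ((n + 1) * v + (2 * n + 4) * u)
                         ≡ (suc n + 2) * ((v + u) + v) + (2 * suc n + 1) * (v + u)
    identity = solve-∀

  closed-step : 5 * weightClosed (suc n) ≡ (suc n + 1) * F (2 + suc n) + (2 * suc n + 4) * F (1 + suc n)
  closed-step = begin
    5 * weightClosed (suc n)     ≡⟨ cong (5 *_) (weightClosed-suc n) ⟩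
    5 * (A + W)                  ≡⟨ distrib A W ⟩
    5 * A + 5 * W                ≡⟨ cong₂ _+_ (cong (5 *_) A≡v) IH₁ ⟩
    5 * v + ((n + 2) * (v + u) + (2 * n + 1) * v)
                                 ≡⟨ identity n u v ⟩
    (suc n + 1) * (v + u) + (2 * suc n + 4) * v ∎
    where
    distrib : ∀ a b → 5 * (a + b) ≡ 5 * a + 5 * b
    distrib = solve-∀
    identity : ∀ n u v → 5 * v + ((n + 2) * (v + u) + (2 * n + 1) * v)
                         ≡ (suc n + 1) * (v + u) + (2 * suc n + 4) * v
    identity = solve-∀

𝓑-Pbar : ∀ n → 𝓑 (Pbar (suc n)) ≡ F (2 + n)
𝓑-Pbar n = trans (sumTo-cong (suc n) (λ k → S-Pbar n (suc k))) (proj₁ (totals-fib n))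

𝓣-Pbar : ∀ n → 5 * 𝓣 (Pbar (suc n)) ≡ (n + 2) * F (3 + n) + (2 * n + 1) * F (2 + n)
𝓣-Pbar n = trans (cong (5 *_) (sumTo-cong (suc n) (λ k → cong (suc k *_) (S-Pbar n (suc k)))))
                 (proj₁ (weights-fib n))

proposition13 : (n : ℕ) → 1 ≤ n →
    5 * F (suc n) * 𝓣 (Pbar n)
      ≡ 𝓑 (Pbar n) * ((n + 1) * F (n + 2) + (2 * n ∸ 1) * F (n + 1))
proposition13 (suc n) _ = begin
  5 * v * 𝓣 (Pbar (suc n))    ≡⟨ rearrange v (𝓣 (Pbar (suc n))) ⟩
  v * (5 * 𝓣 (Pbar (suc n)))  ≡⟨ cong (v *_) (trans (𝓣-Pbar n) reindex) ⟩
  v * rhs                     ≡⟨ cong (_* rhs) (𝓑-Pbar n) ⟨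
  𝓑 (Pbar (suc n)) * rhs      ∎
  where
  open ≡-Reasoning
  v = F (2 + n)
  rhs = (suc n + 1) * F (suc n + 2) + (2 * suc n ∸ 1) * F (suc n + 1)
  rearrange : ∀ a b → 5 * a * b ≡ a * (5 * b)
  rearrange = solve-∀
  reindex : (n + 2) * F (3 + n) + (2 * n + 1) * F (2 + n) ≡ rhs
  reindex = cong₂ _+_ (cong₂ _*_ (e₁ n) (cong F (e₂ n)))
                      (cong₂ _*_ (cong (_∸ 1) (e₃ n)) (cong F (e₄ n)))
    where
    e₁ : ∀ n → n + 2 ≡ suc n + 1
    e₁ = solve-∀
    e₂ : ∀ n → 3 + n ≡ suc n + 2
    e₂ = solve-∀
    e₃ : ∀ n → suc (2 * n + 1) ≡ 2 * suc n
    e₃ = solve-∀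
    e₄ : ∀ n → 2 + n ≡ suc n + 1
    e₄ = solve-∀
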